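{- For every positive integer $k$: $d_i(P_{3k},k)=1$, $\;d_i(P_{3k+1},k+1)=\binom{k+2}{k}$, and $\;d_i(P_{3k+2},k+1)=\binom{k+2}{k+1}$.
   Context: $P_m$ is the path on $m$ vertices. A set $S$ of vertices is an independent dominating set if no two vertices of $S$ are adjacent and every vertex outside $S$ has a neighbour in $S$; $d_i(G,k)$ is the number of independent dominating sets of $G$ of size $k$. -}

module Defs where

open import Data.Nat using (ℕ; zero; suc)
open import Data.Nat.Base using (_≡ᵇ_)
open import Data.Bool using (Bool; true; false; _∧_; _∨_; not; if_then_else_)
open import Data.Fin using (Fin; toℕ)
open import Data.Fin.Subset using (Subset; _∈_; ∣_∣)
open import Data.Vec using (Vec; []; _∷_; lookup)
open import Data.List using (List; []; _∷_; map; _++_; filter; length)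
open import Data.Bool.ListAction using (all; any)
open import Data.Bool.Properties using () renaming (_≟_ to _≟ᵇ_)
open import Data.List.Base using (allFin)
open import Relation.Nullary.Decidable using (Dec; yes; no)
open import Relation.Binary.PropositionalEquality using (_≡_)
open import Function using (_∘_)

pathAdj : (m : ℕ) → Fin m → Fin m → Bool
pathAdj m i j = (toℕ j ≡ᵇ suc (toℕ i)) ∨ (toℕ i ≡ᵇ suc (toℕ j))

mem : {m : ℕ} → Subset m → Fin m → Bool
mem S i = lookup S i

isIndependent : (m : ℕ) → Subset m → Bool
isIndependent m S =
  all (λ i → all (λ j → not (mem S i ∧ mem S j ∧ pathAdj m i j)) (allFin m)) (allFin m)

isDominating : (m : ℕ) → Subset m → Bool
isDominating m S =
  all (λ i → mem S i ∨ any (λ j → mem S j ∧ pathAdj m i j) (allFin m)) (allFin m)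

isIndependentDominating : (m : ℕ) → Subset m → Bool
isIndependentDominating m S = isIndependent m S ∧ isDominating m S

allSubsets : (m : ℕ) → List (Subset m)
allSubsets zero = [] ∷ []
allSubsets (suc m) = map (true ∷_) (allSubsets m) ++ map (false ∷_) (allSubsets m)

d-i-path : (m k : ℕ) → ℕ
d-i-path m k =
  length (filter (λ S → (isIndependentDominating m S ∧ (∣ S ∣ ≡ᵇ k)) ≟ᵇ true) (allSubsets m))

module Submission where

-- A set S of vertices is an independent dominating set iff every
-- vertex v satisfies  "v ∈ S  xor  v has a neighbour in S".  On the path the neighbours
-- of v are v-1 and v+1, so the condition at v only involves three consecutive entries of
-- S and can be checked left to right.  Reading S vertex by vertex, the relevant memory
-- is a three-state automaton: the last vertex read is in S, or it is outside S and
-- already dominated, or outside S and not yet dominated.  Counting accepted extensions of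
-- each size from each state gives three mutually recursive functions, and d_i(P_m,k) is
-- the count from the "outside and dominated" state (the empty prefix behaves like such a
-- vertex).  That count satisfies a(m+3,k+1) = a(m+1,k) + a(m,k), and solving this
-- recurrence along m = 3k, 3k+1, 3k+2 by induction on k gives the three closed forms
-- (Pascal's rule supplies the binomial coefficient).

open import Defs
open import Data.Nat using (ℕ; zero; suc; _+_; _*_; _≡ᵇ_)
open import Data.Nat.Properties using (+-comm; +-assoc; +-suc; *-suc; +-identityʳ; m≤m+n; m+n∸m≡n)
open import Data.Nat.Combinatorics using (_C_; nC1≡n; nCk≡nC[n∸k]; nCk+nC[k+1]≡[n+1]C[k+1])
open import Data.Bool using (Bool; true; false; _∧_; _∨_; not; _xor_)
open import Data.Bool.Properties using (∧-comm; ∧-zeroʳ; ∨-identityʳ; ∧-identityʳ; ∧-commutativeMonoid; xor-is-ok)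
  renaming (_≟_ to _≟ᵇ_)
open import Data.Bool.ListAction using (and; or; all; any)
open import Data.Fin using (Fin; toℕ; zero; suc)
open import Data.Fin.Subset using (Subset; ∣_∣)
open import Data.Vec using ([]; _∷_)
open import Data.List using (List; []; _∷_; map; _++_; filter; length; tabulate; allFin)
open import Data.List.Properties using (map-tabulate; tabulate-cong; filter-++; length-++)
open import Data.Product using (_×_; _,_)
open import Function using (_∘_; id)
open import Relation.Binary.PropositionalEquality using (_≡_; refl; sym; trans; cong; cong₂; module ≡-Reasoning)
open import Algebra.Bundles using (CommutativeMonoid)
open import Algebra.Properties.CommutativeSemigroup
  (CommutativeMonoid.commutativeSemigroup ∧-commutativeMonoid) using (interchange)

open ≡-Reasoning

⋀ : (n : ℕ) → (Fin n → Bool) → Bool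
⋀ n p = and (tabulate p)

⋁ : (n : ℕ) → (Fin n → Bool) → Bool
⋁ n p = or (tabulate p)

all-allFin : ∀ n (p : Fin n → Bool) → all p (allFin n) ≡ ⋀ n p
all-allFin n p = cong and (map-tabulate id p)

any-allFin : ∀ n (p : Fin n → Bool) → any p (allFin n) ≡ ⋁ n p
any-allFin n p = cong or (map-tabulate id p)

⋀-cong : ∀ n {p q : Fin n → Bool} → (∀ i → p i ≡ q i) → ⋀ n p ≡ ⋀ n q
⋀-cong n e = cong and (tabulate-cong e)

⋀-∧ : ∀ n (p q : Fin n → Bool) → ⋀ n (λ i → p i ∧ q i) ≡ ⋀ n p ∧ ⋀ n q
⋀-∧ zero p q = refl
⋀-∧ (suc n) p q = begin
  (p zero ∧ q zero) ∧ ⋀ n (λ i → p (suc i) ∧ q (suc i))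
    ≡⟨ cong ((p zero ∧ q zero) ∧_) (⋀-∧ n (p ∘ suc) (q ∘ suc)) ⟩
  (p zero ∧ q zero) ∧ (⋀ n (p ∘ suc) ∧ ⋀ n (q ∘ suc))
    ≡⟨ interchange (p zero) (q zero) _ _ ⟩
  (p zero ∧ ⋀ n (p ∘ suc)) ∧ (q zero ∧ ⋀ n (q ∘ suc)) ∎

⋀-not-∧ : ∀ n x (p : Fin n → Bool) → ⋀ n (λ j → not (x ∧ p j)) ≡ not (x ∧ ⋁ n p)
⋀-not-∧ zero x p = cong not (sym (∧-zeroʳ x))
⋀-not-∧ (suc n) x p =
  trans (cong (not (x ∧ p zero) ∧_) (⋀-not-∧ n x (p ∘ suc))) (not-∧-∨ x (p zero) _)
  where
  not-∧-∨ : ∀ x a b → not (x ∧ a) ∧ not (x ∧ b) ≡ not (x ∧ (a ∨ b))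
  not-∧-∨ false a b = refl
  not-∧-∨ true true b = refl
  not-∧-∨ true false b = refl

⋁-none : ∀ n (p : Fin n → Bool) → (∀ i → p i ≡ false) → ⋁ n p ≡ false
⋁-none zero p none = refl
⋁-none (suc n) p none = cong₂ _∨_ (none zero) (⋁-none n (p ∘ suc) (none ∘ suc))

first : ∀ {n} → Subset n → Bool
first [] = false
first (a ∷ S) = a

before : ∀ {n} → Bool → Subset n → Fin n → Bool
before l (a ∷ S) zero = l
before l (a ∷ S) (suc i) = before a S i

after : ∀ {n} → Subset n → Fin n → Bool
after (a ∷ S) zero = first S
after (a ∷ S) (suc i) = after S i

hasNeighbour : ∀ {n} → Subset n → Fin n → Bool
hasNeighbour {n} S i = ⋁ n (λ j → mem S j ∧ pathAdj n i j)

neighbour-of-left-end : ∀ {n} (S : Subset n) → ⋁ n (λ j → mem S j ∧ ((toℕ j ≡ᵇ 0) ∨ false)) ≡ first S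
neighbour-of-left-end [] = refl
neighbour-of-left-end (b ∷ S) = trans
  (cong₂ _∨_ (∧-identityʳ b) (⋁-none _ (λ j → mem S j ∧ false) (λ j → ∧-zeroʳ (mem S j))))
  (∨-identityʳ b)

-- Vertex i has a neighbour in S iff S contains i-1 or i+1.  Generalised for the induction
-- by an entry l before vertex 0, which is seen by vertex 0 only.
hasNeighbour-before-after : ∀ {n} l (S : Subset n) i →
  (l ∧ (toℕ i ≡ᵇ 0)) ∨ hasNeighbour S i ≡ before l S i ∨ after S i
hasNeighbour-before-after l (a ∷ S) zero =
  cong₂ _∨_ (∧-identityʳ l) (trans (cong (_∨ ⋁ _ (λ j → mem S j ∧ ((toℕ j ≡ᵇ 0) ∨ false))) (∧-zeroʳ a))
    (neighbour-of-left-end S))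
hasNeighbour-before-after l (a ∷ S) (suc i) =
  trans (cong (_∨ _) (∧-zeroʳ l)) (hasNeighbour-before-after a S i)

hasNeighbour-local : ∀ {n} (S : Subset n) i → hasNeighbour S i ≡ before false S i ∨ after S i
hasNeighbour-local = hasNeighbour-before-after false

independent-local : ∀ n (S : Subset n) →
  isIndependent n S ≡ ⋀ n (λ i → not (mem S i ∧ hasNeighbour S i))
independent-local n S = trans (all-allFin n _)
  (⋀-cong n (λ i → trans (all-allFin n _) (⋀-not-∧ n (mem S i) (λ j → mem S j ∧ pathAdj n i j))))

dominating-local : ∀ n (S : Subset n) → isDominating n S ≡ ⋀ n (λ i → mem S i ∨ hasNeighbour S i)
dominating-local n S = trans (all-allFin n _) (⋀-cong n (λ i → cong (mem S i ∨_) (any-allFin n _)))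

independentDominating-xor : ∀ n (S : Subset n) →
  isIndependentDominating n S ≡ ⋀ n (λ i → mem S i xor hasNeighbour S i)
independentDominating-xor n S = begin
  isIndependent n S ∧ isDominating n S
    ≡⟨ cong₂ _∧_ (independent-local n S) (dominating-local n S) ⟩
  ⋀ n (λ i → not (mem S i ∧ hasNeighbour S i)) ∧ ⋀ n (λ i → mem S i ∨ hasNeighbour S i)
    ≡⟨ sym (⋀-∧ n _ _) ⟩
  ⋀ n (λ i → not (mem S i ∧ hasNeighbour S i) ∧ (mem S i ∨ hasNeighbour S i))
    ≡⟨ ⋀-cong n (λ i → trans (∧-comm (not (mem S i ∧ hasNeighbour S i)) _) (sym (xor-is-ok (mem S i) (hasNeighbour S i)))) ⟩
  ⋀ n (λ i → mem S i xor hasNeighbour S i) ∎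

-- The local condition along the path, with an entry l in front of vertex 0.  It unfolds
-- definitionally as  valid l (a ∷ S) = (a xor (l ∨ first S)) ∧ valid a S.
valid : ∀ {n} → Bool → Subset n → Bool
valid {n} l S = ⋀ n (λ i → mem S i xor (before l S i ∨ after S i))

independentDominating-valid : ∀ n (S : Subset n) → isIndependentDominating n S ≡ valid false S
independentDominating-valid n S = trans (independentDominating-xor n S)
  (⋀-cong n (λ i → cong (mem S i xor_) (hasNeighbour-local S i)))

count : ∀ {A : Set} → (A → Bool) → List A → ℕ
count p xs = length (filter (λ x → p x ≟ᵇ true) xs)

count-++ : ∀ {A : Set} (p : A → Bool) xs ys → count p (xs ++ ys) ≡ count p xs + count p ys
count-++ p xs ys = trans (cong length (filter-++ (λ x → p x ≟ᵇ true) xs ys)) (length-++ (filter _ xs))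

count-map : ∀ {A B : Set} (p : B → Bool) (f : A → B) xs → count p (map f xs) ≡ count (p ∘ f) xs
count-map p f [] = refl
count-map p f (x ∷ xs) with p (f x)
... | true = cong suc (count-map p f xs)
... | false = count-map p f xs

count-cong : ∀ {A : Set} {p q : A → Bool} → (∀ x → p x ≡ q x) → ∀ xs → count p xs ≡ count q xs
count-cong e [] = refl
count-cong {p = p} {q} e (x ∷ xs) with p x | q x | e x
... | true | .true | refl = cong suc (count-cong e xs)
... | false | .false | refl = count-cong e xs

count-none : ∀ {A : Set} (xs : List A) → count (λ _ → false) xs ≡ 0
count-none [] = refl
count-none (x ∷ xs) = count-none xs

count-∧false : ∀ {A : Set} (p : A → Bool) xs → count (λ x → p x ∧ false) xs ≡ 0
count-∧false p xs = trans (count-cong (λ x → ∧-zeroʳ (p x)) xs) (count-none xs)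

count-allSubsets : ∀ m (p : Subset (suc m) → Bool) → count p (allSubsets (suc m)) ≡
  count (λ S → p (true ∷ S)) (allSubsets m) + count (λ S → p (false ∷ S)) (allSubsets m)
count-allSubsets m p = trans (count-++ p (map (true ∷_) (allSubsets m)) _)
  (cong₂ _+_ (count-map p (true ∷_) (allSubsets m)) (count-map p (false ∷_) (allSubsets m)))

-- extensions l a m k: the number of S ⊆ Fin m with ∣ S ∣ = k such that the entries
-- a, S (preceded by l) pass the local test at every vertex, i.e. the ways to finish a path
-- whose last two entries read so far are l and a.
extensions : Bool → Bool → ℕ → ℕ → ℕ
extensions l a m k = count (λ S → valid l (a ∷ S) ∧ (∣ S ∣ ≡ᵇ k)) (allSubsets m)

-- The same numbers by recursion, one function per state of the automaton: the last vertex
-- read is in S; it is outside S but dominated; it is outside S and not yet dominated.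
afterMember afterDominated afterUndominated : ℕ → ℕ → ℕ
afterMember zero zero = 1
afterMember zero (suc k) = 0
afterMember (suc m) k = afterDominated m k
afterDominated zero zero = 1
afterDominated zero (suc k) = 0
afterDominated (suc m) zero = afterUndominated m zero
afterDominated (suc m) (suc k) = afterMember m k + afterUndominated m (suc k)
afterUndominated zero k = 0
afterUndominated (suc m) zero = 0
afterUndominated (suc m) (suc k) = afterMember m k

-- The recursion is the transition table of the automaton: splitting on the next entry b,
-- the test  a xor (l ∨ b)  either rejects or moves to the state (a, b).
member-extensions : ∀ m k → extensions false true m k ≡ afterMember m k
dominated-extensions : ∀ m k → extensions true false m k ≡ afterDominated m k
undominated-extensions : ∀ m k → extensions false false m k ≡ afterUndominated m k

member-extensions zero zero = refl
member-extensions zero (suc k) = refl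
member-extensions (suc m) k = trans (count-allSubsets m _)
  (cong₂ _+_ (count-none (allSubsets m)) (dominated-extensions m k))

dominated-extensions zero zero = refl
dominated-extensions zero (suc k) = refl
dominated-extensions (suc m) zero = trans (count-allSubsets m _)
  (cong₂ _+_ (count-∧false (valid false ∘ (true ∷_)) (allSubsets m)) (undominated-extensions m zero))
dominated-extensions (suc m) (suc k) = trans (count-allSubsets m _)
  (cong₂ _+_ (member-extensions m k) (undominated-extensions m (suc k)))

undominated-extensions zero k = refl
undominated-extensions (suc m) zero = trans (count-allSubsets m _)
  (cong₂ _+_ (count-∧false (valid false ∘ (true ∷_)) (allSubsets m)) (count-none (allSubsets m)))
undominated-extensions (suc m) (suc k) = trans (count-allSubsets m _)
  (trans (cong₂ _+_ (member-extensions m k) (count-none (allSubsets m))) (+-identityʳ _))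

-- The empty prefix acts like a dominated vertex outside S, so d_i(P_m,k) is a count from
-- the "dominated" state.
independentDominatingCount : ∀ m k → d-i-path m k ≡ afterDominated m k
independentDominatingCount m k = trans
  (count-cong (λ S → cong (_∧ (∣ S ∣ ≡ᵇ k)) (independentDominating-valid m S)) (allSubsets m))
  (dominated-extensions m k)

-- The recurrence a(m+3,k+1) = a(m+1,k) + a(m,k) for the dominated-state count: the next
-- member of S is one or two steps ahead.
dominated-recurrence : ∀ m k → afterDominated (3 + m) (suc k) ≡ afterDominated (suc m) k + afterDominated m k
dominated-recurrence m k = refl

three-suc : ∀ k r → 3 * suc k + r ≡ 3 + (3 * k + r)
three-suc k r = cong (_+ r) (*-suc 3 k)

-- k vertices of S dominate at most 3k vertices.
dominated-beyond-3k : ∀ k r → afterDominated (3 * k + suc r) k ≡ 0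
dominated-beyond-3k zero r = undominated-empty r
  where
  undominated-empty : ∀ m → afterUndominated m zero ≡ 0
  undominated-empty zero = refl
  undominated-empty (suc m) = refl
dominated-beyond-3k (suc k) r = begin
  afterDominated (3 * suc k + suc r) (suc k)
    ≡⟨ cong (λ m → afterDominated m (suc k)) (three-suc k (suc r)) ⟩
  afterDominated (3 + (3 * k + suc r)) (suc k)
    ≡⟨ dominated-recurrence (3 * k + suc r) k ⟩
  afterDominated (suc (3 * k + suc r)) k + afterDominated (3 * k + suc r) k
    ≡⟨ cong (λ m → afterDominated m k + afterDominated (3 * k + suc r) k) (sym (+-suc (3 * k) (suc r))) ⟩
  afterDominated (3 * k + suc (suc r)) k + afterDominated (3 * k + suc r) k
    ≡⟨ cong₂ _+_ (dominated-beyond-3k k (suc r)) (dominated-beyond-3k k r) ⟩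
  0 ∎

-- Exactly one set of size k dominates 3k vertices (the vertices 1, 4, 7, ...).
dominated-3k : ∀ k → afterDominated (3 * k) k ≡ 1
dominated-3k zero = refl
dominated-3k (suc k) = begin
  afterDominated (3 * suc k) (suc k)
    ≡⟨ cong (λ m → afterDominated m (suc k)) (*-suc 3 k) ⟩
  afterDominated (3 + 3 * k) (suc k)
    ≡⟨ dominated-recurrence (3 * k) k ⟩
  afterDominated (suc (3 * k)) k + afterDominated (3 * k) k
    ≡⟨ cong₂ _+_ (trans (cong (λ m → afterDominated m k) (+-comm 1 (3 * k))) (dominated-beyond-3k k 0))
                 (dominated-3k k) ⟩
  1 ∎

dominated-3k+2 : ∀ k → afterDominated (2 + 3 * k) (suc k) ≡ 2 + k
dominated-3k+2 zero = refl
dominated-3k+2 (suc k) = begin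
  afterDominated (2 + 3 * suc k) (2 + k)
    ≡⟨ cong (λ m → afterDominated (2 + m) (2 + k)) (*-suc 3 k) ⟩
  afterDominated (3 + (2 + 3 * k)) (2 + k)
    ≡⟨ dominated-recurrence (2 + 3 * k) (suc k) ⟩
  afterDominated (3 + 3 * k) (suc k) + afterDominated (2 + 3 * k) (suc k)
    ≡⟨ cong₂ _+_ (trans (cong (λ m → afterDominated m (suc k)) (sym (*-suc 3 k))) (dominated-3k (suc k)))
                 (dominated-3k+2 k) ⟩
  3 + k ∎

dominated-3k+1 : ∀ k → afterDominated (1 + 3 * k) (suc k) ≡ (2 + k) C 2
dominated-3k+1 zero = refl
dominated-3k+1 (suc k) = begin
  afterDominated (1 + 3 * suc k) (2 + k)
    ≡⟨ cong (λ m → afterDominated (1 + m) (2 + k)) (*-suc 3 k) ⟩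
  afterDominated (3 + (1 + 3 * k)) (2 + k)
    ≡⟨ dominated-recurrence (1 + 3 * k) (suc k) ⟩
  afterDominated (2 + 3 * k) (suc k) + afterDominated (1 + 3 * k) (suc k)
    ≡⟨ cong₂ _+_ (trans (dominated-3k+2 k) (sym (nC1≡n (2 + k)))) (dominated-3k+1 k) ⟩
  (2 + k) C 1 + (2 + k) C 2
    ≡⟨ nCk+nC[k+1]≡[n+1]C[k+1] (2 + k) 1 ⟩
  (3 + k) C 2 ∎

C-symmetric : ∀ a b → (a + b) C a ≡ (a + b) C b
C-symmetric a b = trans (nCk≡nC[n∸k] (m≤m+n a b)) (cong ((a + b) C_) (m+n∸m≡n a b))

mainTheorem13 : ∀ (k : ℕ) → 1 Data.Nat.≤ k →
    (d-i-path (3 * k) k ≡ 1)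
    × (d-i-path (3 * k + 1) (k + 1) ≡ (k + 2) C k)
    × (d-i-path (3 * k + 2) (k + 1) ≡ (k + 2) C (k + 1))
mainTheorem13 k _ = trans (independentDominatingCount (3 * k) k) (dominated-3k k) , plusOne , plusTwo
  where
  plusOne : d-i-path (3 * k + 1) (k + 1) ≡ (k + 2) C k
  plusOne = begin
    d-i-path (3 * k + 1) (k + 1)    ≡⟨ independentDominatingCount (3 * k + 1) (k + 1) ⟩
    afterDominated (3 * k + 1) (k + 1) ≡⟨ cong₂ afterDominated (+-comm (3 * k) 1) (+-comm k 1) ⟩
    afterDominated (1 + 3 * k) (suc k) ≡⟨ dominated-3k+1 k ⟩
    (2 + k) C 2                     ≡⟨ cong (_C 2) (+-comm 2 k) ⟩
    (k + 2) C 2                     ≡⟨ sym (C-symmetric k 2) ⟩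
    (k + 2) C k ∎
  plusTwo : d-i-path (3 * k + 2) (k + 1) ≡ (k + 2) C (k + 1)
  plusTwo = begin
    d-i-path (3 * k + 2) (k + 1)    ≡⟨ independentDominatingCount (3 * k + 2) (k + 1) ⟩
    afterDominated (3 * k + 2) (k + 1) ≡⟨ cong₂ afterDominated (+-comm (3 * k) 2) (+-comm k 1) ⟩
    afterDominated (2 + 3 * k) (suc k) ≡⟨ dominated-3k+2 k ⟩
    2 + k                           ≡⟨ trans (+-comm 2 k) (sym (+-assoc k 1 1)) ⟩
    k + 1 + 1                       ≡⟨ sym (nC1≡n (k + 1 + 1)) ⟩
    (k + 1 + 1) C 1                 ≡⟨ sym (C-symmetric (k + 1) 1) ⟩
    (k + 1 + 1) C (k + 1)           ≡⟨ cong (_C (k + 1)) (+-assoc k 1 1) ⟩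
    (k + 2) C (k + 1) ∎
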